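{- Let $m\ge0$ and $\mathit{Var}=\{x_1,\dots,x_m\}$. There are one-to-one correspondences between the following three sets: (1) the downward closed subsets of $\mathbb{B}^m$; (2) the minimal sets of $\neg$-clauses over $\mathit{Var}$; (3) the normal form diagrams of type $m\to0$, modulo equivalence up to commutativity.
   Context: $\mathbb{B}=\{0,1\}$, $\mathbb{B}^m$ ordered componentwise. A $\neg$-clause over $\mathit{Var}$ is a subset of $\mathit{Var}$; $\mathbf{s}\in\mathbb{B}^m$ satisfies $\varphi$ if $\bigwedge_{x_j\in\varphi}\mathbf{s}_j=0$ (the empty clause is satisfied by nothing), and a set of $\neg$-clauses if it satisfies all of them. A set $\Phi$ of $\neg$-clauses is minimal if removing any one clause yields a set with a strictly larger set of satisfying assignments. Diagrams are built from generators copy $1\to2$, discard $1\to0$, conjunction $2\to1$, unit $0\to1$, counit $1\to0$ (among others), identities and symmetries. A matrix diagram $m\to n$ is $c_1;c_2$ with $c_1$ built only from copy, discard, identities, symmetries and $c_2$ only from conjunction, unit, identities, symmetries; its representing $n\times m$ Boolean matrix $A$ has $A_{ij}=1$ iff the $j$-th left wire is connected by a path of wires to the $i$-th right wire. A diagram $d:m\to0$ is in pre-normal form if $d=d_1;(\text{counit})^{\otimes n}$ with $d_1:m\to n$ a matrix diagram, and its representing matrix is that of $d_1$. It is in normal form if there are no two distinct rows $i\neq j$ of its representing matrix with $A_{ik}\le A_{jk}$ for all $k=1,\dots,m$. Two normal form diagrams with representing $n\times m$ matrices $A,B$ are equivalent up to commutativity if $A$ is obtained from $B$ by permuting rows (every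 row of $A$ is a row of $B$ and vice versa). -}

module Defs where

open import Level using (0ℓ)
open import Data.Nat using (ℕ; zero; suc; _+_)
open import Data.Bool using (Bool; true; false; _∧_; _∨_; not)
open import Data.Bool renaming (_≤_ to _≤ᵇ_) using ()
open import Data.Fin using (Fin; zero; suc; splitAt; _≟_)
open import Data.Sum using (inj₁; inj₂)
open import Data.Vec using (Vec; []; _∷_; lookup)
open import Data.Product using (Σ; Σ-syntax; ∃; ∃-syntax; _×_; _,_; proj₁; proj₂)
open import Data.Fin.Subset using (Subset)
open import Data.Fin.Permutation as P using (Permutation; _⟨$⟩ʳ_; _⟨$⟩ˡ_; _∘ₚ_)
open import Relation.Binary.PropositionalEquality using (_≡_; _≢_; refl; sym; trans; cong)
open import Relation.Binary.Bundles using (Setoid)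
open import Relation.Binary.Structures using (IsEquivalence)
open import Relation.Nullary using (¬_; yes; no)
import Data.Bool
import Data.Vec.Properties as VP

𝔹^ : ℕ → Set
𝔹^ m = Vec Bool m

_≼_ : ∀ {m} → 𝔹^ m → 𝔹^ m → Set
_≼_ {m} s t = ∀ (i : Fin m) → lookup s i ≤ᵇ lookup t i

SubsetOf𝔹 : ℕ → Set
SubsetOf𝔹 m = 𝔹^ m → Bool

DownwardClosed : ∀ {m} → SubsetOf𝔹 m → Set
DownwardClosed {m} S = ∀ (s t : 𝔹^ m) → t ≼ s → S s ≡ true → S t ≡ true

DownSet : ℕ → Set
DownSet m = Σ (SubsetOf𝔹 m) DownwardClosed

DownSetSetoid : ℕ → Setoid 0ℓ 0ℓ
DownSetSetoid m = record
  { Carrier = DownSet m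
  ; _≈_ = λ S T → ∀ s → proj₁ S s ≡ proj₁ T s
  ; isEquivalence = record
    { refl = λ s → refl
    ; sym = λ p s → sym (p s)
    ; trans = λ p q s → trans (p s) (q s) } }

-- (2) ¬-clauses over Var = {x_1,…,x_m}: a clause is a subset of Var
-- (x_j ∈ φ iff lookup φ j ≡ true).

Clause : ℕ → Set
Clause m = Subset m

bigAnd : ∀ {m} → Clause m → 𝔹^ m → Bool
bigAnd [] [] = true
bigAnd (true ∷ φ) (b ∷ s) = b ∧ bigAnd φ s
bigAnd (false ∷ φ) (b ∷ s) = bigAnd φ s

SatClause : ∀ {m} → 𝔹^ m → Clause m → Set
SatClause s φ = bigAnd φ s ≡ false

ClauseSet : ℕ → Set
ClauseSet m = Clause m → Bool

Sat : ∀ {m} → 𝔹^ m → ClauseSet m → Set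
Sat s Φ = ∀ φ → Φ φ ≡ true → SatClause s φ

remove : ∀ {m} → ClauseSet m → Clause m → ClauseSet m
remove Φ φ ψ with VP.≡-dec Data.Bool._≟_ ψ φ
... | yes _ = false
... | no  _ = Φ ψ

StrictlyLarger : ∀ {m} → ClauseSet m → ClauseSet m → Set
StrictlyLarger {m} Ψ Φ =
  (∀ (s : 𝔹^ m) → Sat s Φ → Sat s Ψ) × (∃[ s ] (Sat s Ψ × ¬ Sat s Φ))

Minimal : ∀ {m} → ClauseSet m → Set
Minimal Φ = ∀ φ → Φ φ ≡ true → StrictlyLarger (remove Φ φ) Φ

MinClauseSet : ℕ → Set
MinClauseSet m = Σ (ClauseSet m) Minimal

MinClauseSetoid : ℕ → Setoid 0ℓ 0ℓ
MinClauseSetoid m = record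
  { Carrier = MinClauseSet m
  ; _≈_ = λ Φ Ψ → ∀ φ → proj₁ Φ φ ≡ proj₁ Ψ φ
  ; isEquivalence = record
    { refl = λ s → refl
    ; sym = λ p s → sym (p s)
    ; trans = λ p q s → trans (p s) (q s) } }

-- (3) diagrams.
-- Boolean matrices: Mat n m = n × m matrices (n rows = right wires,
-- m columns = left wires).

Mat : ℕ → ℕ → Set
Mat n m = Fin n → Fin m → Bool

anyFin : ∀ {n} → (Fin n → Bool) → Bool
anyFin {zero} f = false
anyFin {suc n} f = f zero ∨ anyFin (λ i → f (suc i))

_·_ : ∀ {n k m} → Mat n k → Mat k m → Mat n m
(A · B) i j = anyFin (λ l → A i l ∧ B l j)

_⊕_ : ∀ {n m n' m'} → Mat n m → Mat n' m' → Mat (n + n') (m + m')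
_⊕_ {n} {m} A B i j with splitAt n i | splitAt m j
... | inj₁ i' | inj₁ j' = A i' j'
... | inj₂ i' | inj₂ j' = B i' j'
... | _ | _ = false

symMat : Mat 2 2
symMat i j with i ≟ j
... | yes _ = false
... | no  _ = true

data CopyD : ℕ → ℕ → Set where
  copy    : CopyD 1 2
  discard : CopyD 1 0
  idw     : CopyD 1 1
  id₀     : CopyD 0 0
  symm    : CopyD 2 2
  _⨾_     : ∀ {a b c} → CopyD a b → CopyD b c → CopyD a c
  _⊗_     : ∀ {a b c d} → CopyD a b → CopyD c d → CopyD (a + c) (b + d)

data ConjD : ℕ → ℕ → Set where
  conj : ConjD 2 1
  unit : ConjD 0 1
  idw  : ConjD 1 1
  id₀  : ConjD 0 0
  symm : ConjD 2 2
  _⨾_  : ∀ {a b c} → ConjD a b → ConjD b c → ConjD a c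
  _⊗_  : ∀ {a b c d} → ConjD a b → ConjD c d → ConjD (a + c) (b + d)

-- connectivity matrices (entry (i,j) = 1 iff left wire j is connected
-- by a path to right wire i)
⟦_⟧c : ∀ {a b} → CopyD a b → Mat b a
⟦ copy ⟧c    = λ _ _ → true
⟦ discard ⟧c = λ ()
⟦ idw ⟧c     = λ _ _ → true
⟦ id₀ ⟧c     = λ ()
⟦ symm ⟧c    = symMat
⟦ d ⨾ e ⟧c   = ⟦ e ⟧c · ⟦ d ⟧c
⟦ d ⊗ e ⟧c   = ⟦ d ⟧c ⊕ ⟦ e ⟧c

⟦_⟧j : ∀ {a b} → ConjD a b → Mat b a
⟦ conj ⟧j  = λ _ _ → true
⟦ unit ⟧j  = λ _ ()
⟦ idw ⟧j   = λ _ _ → true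
⟦ id₀ ⟧j   = λ ()
⟦ symm ⟧j  = symMat
⟦ d ⨾ e ⟧j = ⟦ e ⟧j · ⟦ d ⟧j
⟦ d ⊗ e ⟧j = ⟦ d ⟧j ⊕ ⟦ e ⟧j

record MatrixDiagram (m n : ℕ) : Set where
  constructor _⨾ᴹ_
  field
    {mid} : ℕ
    c₁ : CopyD m mid
    c₂ : ConjD mid n

matrixOf : ∀ {m n} → MatrixDiagram m n → Mat n m
matrixOf (c₁ ⨾ᴹ c₂) = ⟦ c₂ ⟧j · ⟦ c₁ ⟧c

-- pre-normal form diagram m → 0 : d₁ ; counit^{⊗n}, determined by n and
-- the matrix diagram d₁
record PreNormal (m : ℕ) : Set where
  field
    n  : ℕ
    d₁ : MatrixDiagram m n

reprMatrix : ∀ {m} (d : PreNormal m) → Mat (PreNormal.n d) m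
reprMatrix d = matrixOf (PreNormal.d₁ d)

IsNormalMat : ∀ {n m} → Mat n m → Set
IsNormalMat {n} {m} A =
  ∀ (i j : Fin n) → i ≢ j → ¬ (∀ (k : Fin m) → A i k ≤ᵇ A j k)

NormalForm : ℕ → Set
NormalForm m = Σ (PreNormal m) (λ d → IsNormalMat (reprMatrix d))

-- equivalence up to commutativity: matrices differ by a row permutation
_≈comm_ : ∀ {m} → NormalForm m → NormalForm m → Set
_≈comm_ {m} (d , _) (e , _) =
  Σ[ π ∈ Permutation (PreNormal.n d) (PreNormal.n e) ]
    (∀ i (k : Fin m) → reprMatrix d i k ≡ reprMatrix e (π ⟨$⟩ʳ i) k)

≈comm-isEquivalence : ∀ {m} → IsEquivalence (_≈comm_ {m})
≈comm-isEquivalence = record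
  { refl  = P.id , λ i k → refl
  ; sym   = λ { {d , _} {e , _} (π , p) → P.flip π , λ i k →
              trans (cong (λ x → reprMatrix e x k) (sym (P.inverseʳ π)))
                    (sym (p (π ⟨$⟩ˡ i) k)) }
  ; trans = λ (π , p) (ρ , q) → (π ∘ₚ ρ) , λ i k → trans (p i k) (q (π ⟨$⟩ʳ i) k) }

NormalFormSetoid : ℕ → Setoid 0ℓ 0ℓ
NormalFormSetoid m = record
  { Carrier = NormalForm m
  ; _≈_ = _≈comm_
  ; isEquivalence = ≈comm-isEquivalence }

module Submission where

-- A down-set S is determined by its minimal non-members: they form an antichain of clauses
-- whose models are exactly S, since by well-founded induction on ⊂ every non-member lies above
-- a minimal one; conversely an antichain Φ is recovered as the minimal non-models of its model
-- set, and the antichains are exactly the minimal clause sets.  A normal form diagram is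
-- determined, up to permuting rows, by the set of its rows, and the normal-form condition says
-- exactly that this set is an antichain.  Every Boolean matrix is the matrix of some matrix
-- diagram: the matrix of a copy part is the graph of a function (each right wire is a copy of one
-- left wire) and that of a conjunction part the converse graph of one, every function arises
-- both ways, and one middle wire per 1-entry (i , j), copied from input j and conjoined into
-- output i, realizes the matrix.

open import Defs
open import Data.Bool using (Bool; true; false; _∧_)
open import Data.Bool renaming (_≤_ to _≤ᵇ_) using (b≤b)
import Data.Bool as Bool
open import Data.Bool.Properties using (⇔→≡; ≤-minimum)
open import Data.Fin using (Fin; zero; suc; splitAt; join)
open import Data.Fin.Properties using (splitAt-join; join-splitAt; any?) renaming (_≟_ to _≟ᶠ_)
open import Data.Fin.Permutation using (permutation; _⟨$⟩ʳ_; _⟨$⟩ˡ_; inverseʳ)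
open import Data.Fin.Subset using (Subset; inside; outside; _⊆_; _⊈_; _⊂_)
open import Data.Fin.Subset.Properties
  using ( ⊆-refl; ⊆-reflexive; ⊆-trans; ⊆-⊂-trans; ⊂-irref; _⊆?_; _⊂?_; anySubset?
        ; in⊆in-⇔; out⊆-⇔; drop-∷-⊆; in⊂in; out⊂in; out⊂)
open import Data.Fin.Subset.Induction using (⊂-wellFounded)
open import Data.List using (List; _∷_; [_]; length; filter; cartesianProduct; allFin; map; _++_)
import Data.List as List
open import Data.List.Membership.Propositional using (_∈_)
open import Data.List.Membership.Propositional.Properties
  using ( ∈-lookup; ∈-filter⁺; ∈-filter⁻; ∈-cartesianProduct⁺; ∈-allFin
        ; ∈-map⁺; ∈-map⁻; ∈-++⁺ˡ; ∈-++⁺ʳ)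
open import Data.List.Relation.Unary.Any using (index; here)
open import Data.List.Relation.Unary.Any.Properties using (lookup-index)
import Data.List.Relation.Unary.All as All
import Data.List.Relation.Unary.AllPairs as AllPairs
open import Data.List.Relation.Unary.Unique.Propositional using (Unique)
import Data.List.Relation.Unary.Unique.Propositional.Properties as Unique
open import Data.Nat using (ℕ; zero; suc; _+_)
open import Data.Product using (∃-syntax; ∄-syntax; _×_; _,_; proj₁; proj₂; map₂; swap)
open import Data.Sum using (inj₁; inj₂)
import Data.Sum as Sum
open import Data.Sum.Properties using (inj₁-injective; inj₂-injective)
open import Data.Vec using ([]; _∷_; lookup; tabulate)
import Data.Vec
open import Data.Vec.Properties
  using (∷-injectiveʳ; []=⇒lookup; lookup⇒[]=; ≡-dec; lookup∘tabulate; tabulate∘lookup; tabulate-cong)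
open import Function using (const; _∘_; flip)
open import Function.Bundles using (_⇔_; mk⇔; Equivalence; Inverse)
import Function.Construct.Composition as Composition
open import Function.Definitions using (Injective)
open import Function.Properties.Equivalence using () renaming (trans to ⇔-trans; sym to ⇔-sym)
open import Induction.WellFounded using (Acc; acc)
open import Relation.Binary.PropositionalEquality
  using (_≡_; _≢_; refl; sym; trans; cong; cong₂; subst₂)
open import Relation.Nullary using (¬_; Dec; yes; no; does; ¬?; contradiction)
open import Relation.Nullary.Decidable using (_×-dec_; decidable-stable; does-⇔)
open import Relation.Unary using (Decidable)

open Equivalence using (to; from)

does≡true⇔ : ∀ {A : Set} (a? : Dec A) → does a? ≡ true ⇔ A
does≡true⇔ (yes a) = mk⇔ (const a) (const refl)
does≡true⇔ (no ¬a) = mk⇔ (λ ()) (λ a → contradiction a ¬a)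

≢true⇒≡false : ∀ {b} → b ≢ true → b ≡ false
≢true⇒≡false {false} _ = refl
≢true⇒≡false {true} b≢true = contradiction refl b≢true

_≟ₛ_ : ∀ {m} (p q : Subset m) → Dec (p ≡ q)
_≟ₛ_ = ≡-dec Bool._≟_

∃-lookup⇔∈ : ∀ {A : Set} {xs : List A} {x} → (∃[ l ] List.lookup xs l ≡ x) ⇔ x ∈ xs
∃-lookup⇔∈ = mk⇔ (λ { (l , refl) → ∈-lookup l }) (λ x∈xs → index x∈xs , sym (lookup-index x∈xs))

lookup-injective : ∀ {A : Set} {xs : List A} → Unique xs → Injective _≡_ _≡_ (List.lookup xs)
lookup-injective (_ AllPairs.∷ _) {zero} {zero} _ = refl
lookup-injective (x∉xs AllPairs.∷ _) {zero} {suc l} x≡xs[l] =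
  contradiction x≡xs[l] (All.lookup x∉xs (∈-lookup l))
lookup-injective (x∉xs AllPairs.∷ _) {suc k} {zero} xs[k]≡x =
  contradiction (sym xs[k]≡x) (All.lookup x∉xs (∈-lookup k))
lookup-injective (_ AllPairs.∷ unique) {suc k} {suc l} xs[k]≡xs[l] =
  cong suc (lookup-injective unique xs[k]≡xs[l])

-- Assignments and clauses as subsets of variables

≼⇔⊆ : ∀ {m} {t s : Subset m} → t ≼ s ⇔ t ⊆ s
≼⇔⊆ {t = t} {s} = mk⇔ ≼⇒⊆ ⊆⇒≼
  where
  ≼⇒⊆ : t ≼ s → t ⊆ s
  ≼⇒⊆ t≼s {k} k∈t with lookup t k | []=⇒lookup k∈t | lookup s k in sk | t≼s k
  ... | true | refl | true | b≤b = lookup⇒[]= k s sk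
  ⊆⇒≼ : t ⊆ s → t ≼ s
  ⊆⇒≼ t⊆s k with lookup t k in tk
  ... | false = ≤-minimum _
  ... | true rewrite []=⇒lookup (t⊆s (lookup⇒[]= k t tk)) = b≤b

⊆∧≢⇒⊂ : ∀ {m} {p q : Subset m} → p ⊆ q → p ≢ q → p ⊂ q
⊆∧≢⇒⊂ {p = []} {[]} _ p≢q = contradiction refl p≢q
⊆∧≢⇒⊂ {p = inside ∷ p} {inside ∷ q} p⊆q p≢q =
  in⊂in (⊆∧≢⇒⊂ (drop-∷-⊆ p⊆q) (p≢q ∘ cong (inside ∷_)))
⊆∧≢⇒⊂ {p = inside ∷ p} {outside ∷ q} p⊆q _ = contradiction (p⊆q Data.Vec.here) λ ()
⊆∧≢⇒⊂ {p = outside ∷ p} {inside ∷ q} p⊆q _ = out⊂in (drop-∷-⊆ p⊆q)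
⊆∧≢⇒⊂ {p = outside ∷ p} {outside ∷ q} p⊆q p≢q =
  out⊂ (⊆∧≢⇒⊂ (drop-∷-⊆ p⊆q) (p≢q ∘ cong (outside ∷_)))

bigAnd≡true⇔⊆ : ∀ {m} (φ s : Subset m) → bigAnd φ s ≡ true ⇔ φ ⊆ s
bigAnd≡true⇔⊆ [] [] = mk⇔ (λ _ {_} → ⊆-refl) (const refl)
bigAnd≡true⇔⊆ (inside ∷ φ) (inside ∷ s) = ⇔-trans (bigAnd≡true⇔⊆ φ s) in⊆in-⇔
bigAnd≡true⇔⊆ (inside ∷ φ) (outside ∷ s) = mk⇔ (λ ()) (λ φ⊆s → contradiction (φ⊆s Data.Vec.here) λ ())
bigAnd≡true⇔⊆ (outside ∷ φ) (_ ∷ s) = ⇔-trans (bigAnd≡true⇔⊆ φ s) out⊆-⇔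

Sat⇔∄ : ∀ {m} {s : Subset m} {Φ : ClauseSet m} → Sat s Φ ⇔ (∄[ φ ] (Φ φ ≡ true × φ ⊆ s))
Sat⇔∄ {s = s} {Φ} = mk⇔ ⇒∄ ∄⇒
  where
  ⇒∄ : Sat s Φ → ∄[ φ ] (Φ φ ≡ true × φ ⊆ s)
  ⇒∄ s⊨Φ (φ , Φφ , φ⊆s) with () ← trans (sym (s⊨Φ φ Φφ)) (from (bigAnd≡true⇔⊆ φ s) φ⊆s)
  ∄⇒ : ∄[ φ ] (Φ φ ≡ true × φ ⊆ s) → Sat s Φ
  ∄⇒ ∄violated φ Φφ = ≢true⇒≡false λ φs → ∄violated (φ , Φφ , to (bigAnd≡true⇔⊆ φ s) φs)

-- Minimal clause sets, antichains and down-sets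

Antichain : ∀ {m} → ClauseSet m → Set
Antichain Φ = ∀ {φ ψ} → Φ φ ≡ true → Φ ψ ≡ true → φ ⊆ ψ → φ ≡ ψ

remove≡true⇔ : ∀ {m} (Φ : ClauseSet m) φ ψ → remove Φ φ ψ ≡ true ⇔ (Φ ψ ≡ true × ψ ≢ φ)
remove≡true⇔ Φ φ ψ with ψ ≟ₛ φ
... | yes ψ≡φ = mk⇔ (λ ()) (λ (_ , ψ≢φ) → contradiction ψ≡φ ψ≢φ)
... | no ψ≢φ = mk⇔ (_, ψ≢φ) proj₁

antichain⇒minimal : ∀ {m} {Φ : ClauseSet m} → Antichain Φ → Minimal Φ
antichain⇒minimal {Φ = Φ} antichain φ Φφ = weaker , φ , φ⊨Φ-φ , φ⊭Φ
  where
  weaker : ∀ s → Sat s Φ → Sat s (remove Φ φ)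
  weaker s s⊨Φ ψ Φ-φψ = s⊨Φ ψ (proj₁ (to (remove≡true⇔ Φ φ ψ) Φ-φψ))
  φ⊨Φ-φ : Sat φ (remove Φ φ)
  φ⊨Φ-φ = from Sat⇔∄ λ (ψ , Φ-φψ , ψ⊆φ) →
    let (Φψ , ψ≢φ) = to (remove≡true⇔ Φ φ ψ) Φ-φψ in ψ≢φ (antichain Φψ Φφ ψ⊆φ)
  φ⊭Φ : ¬ Sat φ Φ
  φ⊭Φ φ⊨Φ = to Sat⇔∄ φ⊨Φ (φ , Φφ , ⊆-refl)

violates-removed : ∀ {m} {Φ : ClauseSet m} {ψ s} → Sat s (remove Φ ψ) → ¬ Sat s Φ → ψ ⊆ s
violates-removed {Φ = Φ} {ψ} {s} s⊨Φ-ψ s⊭Φ =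
  decidable-stable (ψ ⊆? s) λ ψ⊈s → s⊭Φ (from Sat⇔∄ (∄violated ψ⊈s))
  where
  ∄violated : ψ ⊈ s → ∄[ χ ] (Φ χ ≡ true × χ ⊆ s)
  ∄violated ψ⊈s (χ , Φχ , χ⊆s) with χ ≟ₛ ψ
  ... | yes refl = ψ⊈s χ⊆s
  ... | no χ≢ψ = to Sat⇔∄ s⊨Φ-ψ (χ , from (remove≡true⇔ Φ ψ χ) (Φχ , χ≢ψ) , χ⊆s)

minimal⇒antichain : ∀ {m} {Φ : ClauseSet m} → Minimal Φ → Antichain Φ
minimal⇒antichain {Φ = Φ} minimal {φ} {ψ} Φφ Φψ φ⊆ψ with φ ≟ₛ ψ
... | yes φ≡ψ = φ≡ψ
... | no φ≢ψ =
  let (_ , s , s⊨Φ-ψ , s⊭Φ) = minimal ψ Φψ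
  in contradiction (φ , from (remove≡true⇔ Φ ψ φ) (Φφ , φ≢ψ)
                      , λ {_} → ⊆-trans φ⊆ψ (violates-removed s⊨Φ-ψ s⊭Φ))
                   (to Sat⇔∄ s⊨Φ-ψ)

models : ∀ {m} → ClauseSet m → SubsetOf𝔹 m
models Φ s = does (¬? (anySubset? λ φ → Φ φ Bool.≟ true ×-dec φ ⊆? s))

models≡true⇔ : ∀ {m} {Φ : ClauseSet m} {s} → models Φ s ≡ true ⇔ Sat s Φ
models≡true⇔ {Φ = Φ} {s} with anySubset? (λ φ → Φ φ Bool.≟ true ×-dec φ ⊆? s)
... | yes violated = mk⇔ (λ ()) (λ s⊨Φ → contradiction violated (to Sat⇔∄ s⊨Φ))
... | no ∄violated = mk⇔ (const (from Sat⇔∄ ∄violated)) (const refl)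

models≡false⇔ : ∀ {m} {Φ : ClauseSet m} {s} → models Φ s ≡ false ⇔ (∃[ φ ] (Φ φ ≡ true × φ ⊆ s))
models≡false⇔ {Φ = Φ} {s} with anySubset? (λ φ → Φ φ Bool.≟ true ×-dec φ ⊆? s)
... | yes violated = mk⇔ (const violated) (const refl)
... | no ∄violated = mk⇔ (λ ()) (λ violated → contradiction violated ∄violated)

models-downwardClosed : ∀ {m} (Φ : ClauseSet m) → DownwardClosed (models Φ)
models-downwardClosed Φ s t t≼s s⊨Φ = from models≡true⇔ (from Sat⇔∄ λ (φ , Φφ , φ⊆t) →
  to Sat⇔∄ (to models≡true⇔ s⊨Φ) (φ , Φφ , λ {_} → ⊆-trans φ⊆t (to ≼⇔⊆ t≼s)))

MinimalNonMember : ∀ {m} → SubsetOf𝔹 m → Subset m → Set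
MinimalNonMember S φ = S φ ≡ false × (∄[ t ] (t ⊂ φ × S t ≡ false))

minimalNonMember? : ∀ {m} (S : SubsetOf𝔹 m) → Decidable (MinimalNonMember S)
minimalNonMember? S φ = S φ Bool.≟ false ×-dec ¬? (anySubset? λ t → t ⊂? φ ×-dec S t Bool.≟ false)

minimalNonMembers : ∀ {m} → SubsetOf𝔹 m → ClauseSet m
minimalNonMembers S φ = does (minimalNonMember? S φ)

minimalNonMembers≡true⇔ : ∀ {m} (S : SubsetOf𝔹 m) φ →
                          minimalNonMembers S φ ≡ true ⇔ MinimalNonMember S φ
minimalNonMembers≡true⇔ S φ = does≡true⇔ (minimalNonMember? S φ)

minimalNonMembers-antichain : ∀ {m} (S : SubsetOf𝔹 m) → Antichain (minimalNonMembers S)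
minimalNonMembers-antichain S {φ} {ψ} mφ mψ φ⊆ψ with φ ≟ₛ ψ
... | yes φ≡ψ = φ≡ψ
... | no φ≢ψ = contradiction (φ , ⊆∧≢⇒⊂ φ⊆ψ φ≢ψ , proj₁ (to (minimalNonMembers≡true⇔ S φ) mφ))
                             (proj₂ (to (minimalNonMembers≡true⇔ S ψ) mψ))

minimalNonMember-⊆ : ∀ {m} (S : SubsetOf𝔹 m) {s} → S s ≡ false →
                     ∃[ φ ] (φ ⊆ s × MinimalNonMember S φ)
minimalNonMember-⊆ S {s} Ss = descend s (⊂-wellFounded s) Ss
  where
  descend : ∀ s → Acc _⊂_ s → S s ≡ false → ∃[ φ ] (φ ⊆ s × MinimalNonMember S φ)
  descend s (acc below) Ss with anySubset? (λ t → t ⊂? s ×-dec S t Bool.≟ false)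
  ... | no ∄smaller = s , ⊆-refl , Ss , ∄smaller
  ... | yes (t , t⊂s , St) =
    let (φ , φ⊆t , φ-min) = descend t (below t⊂s) St in φ , ⊆-trans φ⊆t (proj₁ t⊂s) , φ-min

models-minimalNonMembers : ∀ {m} (S : SubsetOf𝔹 m) → DownwardClosed S →
                           ∀ s → models (minimalNonMembers S) s ≡ S s
models-minimalNonMembers S down s with S s in Ss
... | true = from models≡true⇔ (from Sat⇔∄ λ (φ , mφ , φ⊆s) →
  contradiction (trans (sym (down s φ (from ≼⇔⊆ φ⊆s) Ss)) (proj₁ (to (minimalNonMembers≡true⇔ S φ) mφ)))
                λ ())
... | false = let (φ , φ⊆s , φ-min) = minimalNonMember-⊆ S Ss in
  from models≡false⇔ (φ , from (minimalNonMembers≡true⇔ S φ) φ-min , φ⊆s)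

minimalNonMembers-models : ∀ {m} (Φ : ClauseSet m) → Antichain Φ →
                           ∀ φ → minimalNonMembers (models Φ) φ ≡ Φ φ
minimalNonMembers-models Φ antichain φ =
  ⇔→≡ (⇔-trans (minimalNonMembers≡true⇔ (models Φ) φ) (mk⇔ clause (λ Φφ → unsat Φφ , ∄smaller Φφ)))
  where
  unsat : ∀ {ψ} → Φ ψ ≡ true → models Φ ψ ≡ false
  unsat {ψ} Φψ = from models≡false⇔ (ψ , Φψ , ⊆-refl)
  clause : MinimalNonMember (models Φ) φ → Φ φ ≡ true
  clause (φ⊭Φ , ∄smaller) with to models≡false⇔ φ⊭Φ
  ... | ψ , Φψ , ψ⊆φ with ψ ≟ₛ φ
  ...   | yes refl = Φψ
  ...   | no ψ≢φ = contradiction (ψ , ⊆∧≢⇒⊂ ψ⊆φ ψ≢φ , unsat Φψ) ∄smaller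
  ∄smaller : Φ φ ≡ true → ∄[ t ] (t ⊂ φ × models Φ t ≡ false)
  ∄smaller Φφ (t , t⊂φ , t⊭Φ) with to models≡false⇔ t⊭Φ
  ... | ψ , Φψ , ψ⊆t with refl ← antichain Φψ Φφ (⊆-trans ψ⊆t (proj₁ t⊂φ)) =
    ⊂-irref refl (⊆-⊂-trans ψ⊆t t⊂φ)

models-cong : ∀ {m} {Φ Ψ : ClauseSet m} → (∀ φ → Φ φ ≡ Ψ φ) → ∀ s → models Φ s ≡ models Ψ s
models-cong {Φ = Φ} {Ψ} Φ≗Ψ s =
  ⇔→≡ (⇔-trans models≡false⇔
        (⇔-trans (mk⇔ (violated Φ≗Ψ) (violated (sym ∘ Φ≗Ψ))) (⇔-sym models≡false⇔)))
  where
  violated : ∀ {Φ Ψ : ClauseSet _} → (∀ φ → Φ φ ≡ Ψ φ) →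
             ∃[ φ ] (Φ φ ≡ true × φ ⊆ s) → ∃[ φ ] (Ψ φ ≡ true × φ ⊆ s)
  violated Φ≗Ψ (φ , Φφ , φ⊆s) = φ , trans (sym (Φ≗Ψ φ)) Φφ , φ⊆s

minimalNonMembers-cong : ∀ {m} {S T : SubsetOf𝔹 m} → (∀ s → S s ≡ T s) →
                         ∀ φ → minimalNonMembers S φ ≡ minimalNonMembers T φ
minimalNonMembers-cong S≗T φ =
  does-⇔ (mk⇔ (minimal S≗T) (minimal (sym ∘ S≗T))) (minimalNonMember? _ φ) (minimalNonMember? _ φ)
  where
  minimal : ∀ {S T : SubsetOf𝔹 _} → (∀ s → S s ≡ T s) → MinimalNonMember S φ → MinimalNonMember T φ
  minimal S≗T (Sφ , ∄smaller) =
    trans (sym (S≗T φ)) Sφ , λ (t , t⊂φ , Tt) → ∄smaller (t , t⊂φ , trans (S≗T t) Tt)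

downSet≅minClauseSet : ∀ m → Inverse (DownSetSetoid m) (MinClauseSetoid m)
downSet≅minClauseSet m = record
  { to        = to′
  ; from      = from′
  ; to-cong   = minimalNonMembers-cong
  ; from-cong = models-cong
  ; inverse   = (λ {Φ} S≈Φ φ → trans (minimalNonMembers-cong S≈Φ φ) (to∘from Φ φ))
              , (λ {S} Φ≈S s → trans (models-cong Φ≈S s) (from∘to S s))
  }
  where
  to′ : DownSet m → MinClauseSet m
  to′ S = minimalNonMembers (proj₁ S) , antichain⇒minimal (minimalNonMembers-antichain (proj₁ S))
  from′ : MinClauseSet m → DownSet m
  from′ Φ = models (proj₁ Φ) , models-downwardClosed (proj₁ Φ)
  to∘from : ∀ Φ φ → minimalNonMembers (models (proj₁ Φ)) φ ≡ proj₁ Φ φ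
  to∘from (Φ , minimal) = minimalNonMembers-models Φ (minimal⇒antichain minimal)
  from∘to : ∀ S s → models (minimalNonMembers (proj₁ S)) s ≡ proj₁ S s
  from∘to (S , down) = models-minimalNonMembers S down

-- Matrices of copy and conjunction diagrams

anyFin≡true⇔ : ∀ {n} {f : Fin n → Bool} → anyFin f ≡ true ⇔ (∃[ i ] f i ≡ true)
anyFin≡true⇔ {zero} = mk⇔ (λ ()) (λ ())
anyFin≡true⇔ {suc n} {f} with f zero in f0
... | true = mk⇔ (const (zero , f0)) (const refl)
... | false = mk⇔ (λ any → let (i , fi) = to anyFin≡true⇔ any in suc i , fi) there
  where
  there : ∃[ i ] f i ≡ true → anyFin (f ∘ suc) ≡ true
  there (zero , f0≡true) = contradiction (trans (sym f0≡true) f0) λ ()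
  there (suc i , fi) = from anyFin≡true⇔ (i , fi)

∧≡true⇔ : ∀ {a b} → a ∧ b ≡ true ⇔ (a ≡ true × b ≡ true)
∧≡true⇔ {true} = mk⇔ (refl ,_) proj₂
∧≡true⇔ {false} = mk⇔ (λ ()) (λ ())

·≡true⇔ : ∀ {n k m} (A : Mat n k) (B : Mat k m) {i j} →
          (A · B) i j ≡ true ⇔ (∃[ l ] (A i l ≡ true × B l j ≡ true))
·≡true⇔ A B = mk⇔ (λ path → let (l , Ail∧Blj) = to anyFin≡true⇔ path in l , to ∧≡true⇔ Ail∧Blj)
                  (λ (l , Ail , Blj) → from anyFin≡true⇔ (l , from ∧≡true⇔ (Ail , Blj)))

·-flip : ∀ {n k m} (A : Mat n k) (B : Mat k m) {i j} →
         (A · B) i j ≡ true ⇔ (flip B · flip A) j i ≡ true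
·-flip A B =
  ⇔-trans (·≡true⇔ A B) (⇔-trans (mk⇔ (map₂ swap) (map₂ swap)) (⇔-sym (·≡true⇔ (flip B) (flip A))))

⊕-flip : ∀ {n m n′ m′} (A : Mat n m) (B : Mat n′ m′) i j → (A ⊕ B) i j ≡ (flip A ⊕ flip B) j i
⊕-flip {n} {m} A B i j with splitAt n i | splitAt m j
... | inj₁ _ | inj₁ _ = refl
... | inj₁ _ | inj₂ _ = refl
... | inj₂ _ | inj₁ _ = refl
... | inj₂ _ | inj₂ _ = refl

IsGraphOf : ∀ {a b} → (Fin a → Fin b) → Mat a b → Set
IsGraphOf f A = ∀ i j → A i j ≡ true ⇔ f i ≡ j

·-graph : ∀ {n k m} {f : Fin n → Fin k} {g : Fin k → Fin m} {A : Mat n k} {B : Mat k m} →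
          IsGraphOf f A → IsGraphOf g B → IsGraphOf (g ∘ f) (A · B)
·-graph {f = f} {g} {A} {B} fA gB i j =
  ⇔-trans (·≡true⇔ A B) (mk⇔ compose (λ gfi≡j → f i , from (fA i (f i)) refl , from (gB (f i) j) gfi≡j))
  where
  compose : ∃[ l ] (A i l ≡ true × B l j ≡ true) → g (f i) ≡ j
  compose (l , Ail , Blj) with refl ← to (fA i l) Ail = to (gB l j) Blj

_⊎ᶠ_ : ∀ {a b c d} → (Fin a → Fin b) → (Fin c → Fin d) → Fin (a + c) → Fin (b + d)
_⊎ᶠ_ {a} {b} {c} {d} f g = join b d ∘ Sum.map f g ∘ splitAt a

join≡⇔ : ∀ b {d} {x} {j : Fin (b + d)} → join b d x ≡ j ⇔ x ≡ splitAt b j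
join≡⇔ b {d} {x} {j} = mk⇔ (λ e → trans (sym (splitAt-join b d x)) (cong (splitAt b) e))
                            (λ e → trans (cong (join b d) e) (join-splitAt b d j))

⊕-graph : ∀ {a b c d} {f : Fin a → Fin b} {g : Fin c → Fin d} {A : Mat a b} {B : Mat c d} →
          IsGraphOf f A → IsGraphOf g B → IsGraphOf (f ⊎ᶠ g) (A ⊕ B)
⊕-graph {a} {b} {f = f} {g} {A} {B} fA gB i j = ⇔-trans blockwise (⇔-sym (join≡⇔ b))
  where
  blockwise : (A ⊕ B) i j ≡ true ⇔ Sum.map f g (splitAt a i) ≡ splitAt b j
  blockwise with splitAt a i | splitAt b j
  ... | inj₁ i′ | inj₁ j′ = ⇔-trans (fA i′ j′) (mk⇔ (cong inj₁) inj₁-injective)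
  ... | inj₁ _  | inj₂ _  = mk⇔ (λ ()) (λ ())
  ... | inj₂ _  | inj₁ _  = mk⇔ (λ ()) (λ ())
  ... | inj₂ i′ | inj₂ j′ = ⇔-trans (gB i′ j′) (mk⇔ (cong inj₂) inj₂-injective)

source : ∀ {a b} → CopyD a b → Fin b → Fin a
source copy _ = zero
source idw l = l
source symm zero = suc zero
source symm (suc _) = zero
source (d ⨾ e) = source d ∘ source e
source (d ⊗ e) = source d ⊎ᶠ source e

target : ∀ {a b} → ConjD a b → Fin a → Fin b
target conj _ = zero
target idw l = l
target symm zero = suc zero
target symm (suc _) = zero
target (d ⨾ e) = target e ∘ target d
target (d ⊗ e) = target d ⊎ᶠ target e

copy-graph : ∀ {a b} (d : CopyD a b) → IsGraphOf (source d) ⟦ d ⟧c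
copy-graph copy _ zero = mk⇔ (const refl) (const refl)
copy-graph idw zero zero = mk⇔ (const refl) (const refl)
copy-graph symm zero zero = mk⇔ (λ ()) (λ ())
copy-graph symm zero (suc zero) = mk⇔ (const refl) (const refl)
copy-graph symm (suc zero) zero = mk⇔ (const refl) (const refl)
copy-graph symm (suc zero) (suc zero) = mk⇔ (λ ()) (λ ())
copy-graph (d ⨾ e) = ·-graph (copy-graph e) (copy-graph d)
copy-graph (d ⊗ e) = ⊕-graph (copy-graph d) (copy-graph e)

conj-graph : ∀ {a b} (d : ConjD a b) → IsGraphOf (target d) (flip ⟦ d ⟧j)
conj-graph conj _ zero = mk⇔ (const refl) (const refl)
conj-graph idw zero zero = mk⇔ (const refl) (const refl)
conj-graph symm zero zero = mk⇔ (λ ()) (λ ())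
conj-graph symm zero (suc zero) = mk⇔ (const refl) (const refl)
conj-graph symm (suc zero) zero = mk⇔ (const refl) (const refl)
conj-graph symm (suc zero) (suc zero) = mk⇔ (λ ()) (λ ())
conj-graph (d ⨾ e) l i = ⇔-trans (·-flip ⟦ e ⟧j ⟦ d ⟧j) (·-graph (conj-graph d) (conj-graph e) l i)
conj-graph (d ⊗ e) l i rewrite ⊕-flip ⟦ d ⟧j ⟦ e ⟧j i l = ⊕-graph (conj-graph d) (conj-graph e) l i

matrixOf≡true⇔ : ∀ {m k n} (c₁ : CopyD m k) (c₂ : ConjD k n) {i j} →
                 matrixOf (c₁ ⨾ᴹ c₂) i j ≡ true ⇔ (∃[ l ] (target c₂ l ≡ i × source c₁ l ≡ j))
matrixOf≡true⇔ c₁ c₂ {i} {j} = ⇔-trans (·≡true⇔ ⟦ c₂ ⟧j ⟦ c₁ ⟧c)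
  (mk⇔ (λ (l , c₂il , c₁lj) → l , to (conj-graph c₂ l i) c₂il , to (copy-graph c₁ l j) c₁lj)
       (λ (l , τl≡i , σl≡j) → l , from (conj-graph c₂ l i) τl≡i , from (copy-graph c₁ l j) σl≡j))

-- Realizing matrices by matrix diagrams

idᶜ : ∀ n → CopyD n n
idᶜ zero = id₀
idᶜ (suc n) = idw ⊗ idᶜ n

source-idᶜ : ∀ {n} (l : Fin n) → source (idᶜ n) l ≡ l
source-idᶜ zero = refl
source-idᶜ (suc l) = cong suc (source-idᶜ l)

discardAll : ∀ n → CopyD n 0
discardAll zero = id₀
discardAll (suc n) = discard ⊗ discardAll n

copyTo : ∀ {n} → Fin n → CopyD n (suc n)
copyTo {suc n} zero = copy ⊗ idᶜ n
copyTo {suc n} (suc a) = (idw ⊗ copyTo a) ⨾ (symm ⊗ idᶜ n)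

source-copyTo-zero : ∀ {n} (a : Fin n) → source (copyTo a) zero ≡ a
source-copyTo-zero {suc n} zero = refl
source-copyTo-zero {suc n} (suc a) = cong suc (source-copyTo-zero a)

source-copyTo-suc : ∀ {n} (a : Fin n) l → source (copyTo a) (suc l) ≡ l
source-copyTo-suc {suc n} zero zero = refl
source-copyTo-suc {suc n} zero (suc l) = cong suc (source-idᶜ l)
source-copyTo-suc {suc n} (suc a) zero = refl
source-copyTo-suc {suc n} (suc a) (suc l) =
  cong suc (trans (source-copyTo-suc a (source (idᶜ n) l)) (source-idᶜ l))

copyAlong : ∀ {k n} → (Fin k → Fin n) → CopyD n k
copyAlong {zero} {n} σ = discardAll n
copyAlong {suc k} σ = copyTo (σ zero) ⨾ (idw ⊗ copyAlong (σ ∘ suc))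

source-copyAlong : ∀ {k n} (σ : Fin k → Fin n) l → source (copyAlong σ) l ≡ σ l
source-copyAlong {suc k} σ zero = source-copyTo-zero (σ zero)
source-copyAlong {suc k} σ (suc l) =
  trans (source-copyTo-suc (σ zero) _) (source-copyAlong (σ ∘ suc) l)

idʲ : ∀ n → ConjD n n
idʲ zero = id₀
idʲ (suc n) = idw ⊗ idʲ n

target-idʲ : ∀ {n} (l : Fin n) → target (idʲ n) l ≡ l
target-idʲ zero = refl
target-idʲ (suc l) = cong suc (target-idʲ l)

unitAll : ∀ n → ConjD 0 n
unitAll zero = id₀
unitAll (suc n) = unit ⊗ unitAll n

mergeInto : ∀ {n} → Fin n → ConjD (suc n) n
mergeInto {suc n} zero = conj ⊗ idʲ n
mergeInto {suc n} (suc a) = (symm ⊗ idʲ n) ⨾ (idw ⊗ mergeInto a)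

target-mergeInto-zero : ∀ {n} (a : Fin n) → target (mergeInto a) zero ≡ a
target-mergeInto-zero {suc n} zero = refl
target-mergeInto-zero {suc n} (suc a) = cong suc (target-mergeInto-zero a)

target-mergeInto-suc : ∀ {n} (a : Fin n) l → target (mergeInto a) (suc l) ≡ l
target-mergeInto-suc {suc n} zero zero = refl
target-mergeInto-suc {suc n} zero (suc l) = cong suc (target-idʲ l)
target-mergeInto-suc {suc n} (suc a) zero = refl
target-mergeInto-suc {suc n} (suc a) (suc l) =
  cong suc (trans (target-mergeInto-suc a (target (idʲ n) l)) (target-idʲ l))

conjAlong : ∀ {k n} → (Fin k → Fin n) → ConjD k n
conjAlong {zero} {n} τ = unitAll n
conjAlong {suc k} τ = (idw ⊗ conjAlong (τ ∘ suc)) ⨾ mergeInto (τ zero)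

target-conjAlong : ∀ {k n} (τ : Fin k → Fin n) l → target (conjAlong τ) l ≡ τ l
target-conjAlong {suc k} τ zero = target-mergeInto-zero (τ zero)
target-conjAlong {suc k} τ (suc l) =
  trans (target-mergeInto-suc (τ zero) _) (target-conjAlong (τ ∘ suc) l)

entries : ∀ {n m} → Mat n m → List (Fin n × Fin m)
entries {n} {m} A =
  filter (λ (i , j) → A i j Bool.≟ true) (cartesianProduct (allFin n) (allFin m))

∈-entries⇔ : ∀ {n m} {A : Mat n m} {i j} → (i , j) ∈ entries A ⇔ A i j ≡ true
∈-entries⇔ {n} {m} = mk⇔ (proj₂ ∘ ∈-filter⁻ _ {xs = cartesianProduct (allFin n) (allFin m)})
                         (∈-filter⁺ _ (∈-cartesianProduct⁺ (∈-allFin _) (∈-allFin _)))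

realize : ∀ {n m} → Mat n m → MatrixDiagram m n
realize A = copyAlong (proj₂ ∘ List.lookup (entries A)) ⨾ᴹ conjAlong (proj₁ ∘ List.lookup (entries A))

matrixOf-realize : ∀ {n m} (A : Mat n m) i j → matrixOf (realize A) i j ≡ A i j
matrixOf-realize A i j =
  ⇔→≡ (⇔-trans (matrixOf≡true⇔ (copyAlong (proj₂ ∘ entry)) (conjAlong (proj₁ ∘ entry)))
        (⇔-trans wires (⇔-trans ∃-lookup⇔∈ ∈-entries⇔)))
  where
  entry = List.lookup (entries A)
  wires : (∃[ l ] (target (conjAlong (proj₁ ∘ entry)) l ≡ i × source (copyAlong (proj₂ ∘ entry)) l ≡ j))
          ⇔ (∃[ l ] entry l ≡ (i , j))
  wires = mk⇔
    (λ (l , τl≡i , σl≡j) → l , cong₂ _,_ (trans (sym (target-conjAlong _ l)) τl≡i)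
                                         (trans (sym (source-copyAlong _ l)) σl≡j))
    (λ (l , entry≡ij) → l , trans (target-conjAlong _ l) (cong proj₁ entry≡ij)
                          , trans (source-copyAlong _ l) (cong proj₂ entry≡ij))

-- Normal forms and antichains of clauses

allSubsets : ∀ m → List (Subset m)
allSubsets zero = [ [] ]
allSubsets (suc m) = map (inside ∷_) (allSubsets m) ++ map (outside ∷_) (allSubsets m)

∈-allSubsets : ∀ {m} (p : Subset m) → p ∈ allSubsets m
∈-allSubsets [] = here refl
∈-allSubsets (inside ∷ p) = ∈-++⁺ˡ (∈-map⁺ (inside ∷_) (∈-allSubsets p))
∈-allSubsets {suc m} (outside ∷ p) =
  ∈-++⁺ʳ (map (inside ∷_) (allSubsets m)) (∈-map⁺ (outside ∷_) (∈-allSubsets p))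

allSubsets-unique : ∀ m → Unique (allSubsets m)
allSubsets-unique zero = All.[] AllPairs.∷ AllPairs.[]
allSubsets-unique (suc m) =
  Unique.++⁺ (Unique.map⁺ ∷-injectiveʳ (allSubsets-unique m))
             (Unique.map⁺ ∷-injectiveʳ (allSubsets-unique m))
             disjoint
  where
  disjoint : ∀ {p} → ¬ (p ∈ map (inside ∷_) (allSubsets m) × p ∈ map (outside ∷_) (allSubsets m))
  disjoint (p∈ins , p∈outs) with ∈-map⁻ (inside ∷_) p∈ins | ∈-map⁻ (outside ∷_) p∈outs
  ... | _ , _ , refl | _ , _ , ()

row : ∀ {m} (d : PreNormal m) → Fin (PreNormal.n d) → Subset m
row d i = tabulate (reprMatrix d i)

pointwise-≤⇔⊆ : ∀ {m} (f g : Fin m → Bool) → (∀ k → f k ≤ᵇ g k) ⇔ tabulate f ⊆ tabulate g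
pointwise-≤⇔⊆ f g = ⇔-trans (mk⇔ (λ f≤g k → subst₂ _≤ᵇ_ (sym (f≡ k)) (sym (g≡ k)) (f≤g k))
                                 (λ f≼g k → subst₂ _≤ᵇ_ (f≡ k) (g≡ k) (f≼g k)))
                            ≼⇔⊆
  where
  f≡ = lookup∘tabulate f
  g≡ = lookup∘tabulate g

RowsAntichain : ∀ {m} → PreNormal m → Set
RowsAntichain d = ∀ {i j} → row d i ⊆ row d j → i ≡ j

normal⇔rowsAntichain : ∀ {m} (d : PreNormal m) → IsNormalMat (reprMatrix d) ⇔ RowsAntichain d
normal⇔rowsAntichain d =
  mk⇔ rowsAntichain (λ antichain i j i≢j i≤j → i≢j (antichain (to (pointwise-≤⇔⊆ _ _) i≤j)))
  where
  rowsAntichain : IsNormalMat (reprMatrix d) → RowsAntichain d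
  rowsAntichain normal {i} {j} i⊆j with i ≟ᶠ j
  ... | yes i≡j = i≡j
  ... | no i≢j = contradiction (from (pointwise-≤⇔⊆ _ _) i⊆j) (normal i j i≢j)

rowSet : ∀ {m} → PreNormal m → ClauseSet m
rowSet d φ = does (any? λ i → row d i ≟ₛ φ)

rowSet≡true⇔ : ∀ {m} (d : PreNormal m) {φ} → rowSet d φ ≡ true ⇔ (∃[ i ] row d i ≡ φ)
rowSet≡true⇔ d {φ} = does≡true⇔ (any? λ i → row d i ≟ₛ φ)

rowSet-antichain : ∀ {m} (d : PreNormal m) → RowsAntichain d → Antichain (rowSet d)
rowSet-antichain d antichain dφ dψ φ⊆ψ with to (rowSet≡true⇔ d) dφ | to (rowSet≡true⇔ d) dψ
... | i , refl | j , refl with refl ← antichain φ⊆ψ = refl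

listDiagram : ∀ {m} → List (Subset m) → PreNormal m
listDiagram L = record { n = length L ; d₁ = realize (λ i → lookup (List.lookup L i)) }

row-listDiagram : ∀ {m} (L : List (Subset m)) i → row (listDiagram L) i ≡ List.lookup L i
row-listDiagram L i = trans (tabulate-cong (matrixOf-realize _ i)) (tabulate∘lookup _)

clauses : ∀ {m} → ClauseSet m → List (Subset m)
clauses {m} Φ = filter (λ φ → Φ φ Bool.≟ true) (allSubsets m)

∈-clauses⇔ : ∀ {m} {Φ : ClauseSet m} {φ} → φ ∈ clauses Φ ⇔ Φ φ ≡ true
∈-clauses⇔ {m} {φ = φ} = mk⇔ (proj₂ ∘ ∈-filter⁻ _ {xs = allSubsets m}) (∈-filter⁺ _ (∈-allSubsets φ))

clauseDiagram : ∀ {m} → ClauseSet m → PreNormal m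
clauseDiagram Φ = listDiagram (clauses Φ)

rows-clauseDiagram⇔ : ∀ {m} (Φ : ClauseSet m) {φ} → (∃[ i ] row (clauseDiagram Φ) i ≡ φ) ⇔ Φ φ ≡ true
rows-clauseDiagram⇔ Φ = ⇔-trans (mk⇔ (λ (i , e) → i , trans (sym (row-listDiagram (clauses Φ) i)) e)
                                     (λ (i , e) → i , trans (row-listDiagram (clauses Φ) i) e))
                                (⇔-trans ∃-lookup⇔∈ (∈-clauses⇔ {Φ = Φ}))

clauseDiagram-rowsAntichain : ∀ {m} (Φ : ClauseSet m) → Antichain Φ → RowsAntichain (clauseDiagram Φ)
clauseDiagram-rowsAntichain {m} Φ antichain {i} {j} i⊆j =
  lookup-injective (Unique.filter⁺ _ (allSubsets-unique m))
    (antichain (clause i) (clause j)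
      (subst₂ _⊆_ (row-listDiagram (clauses Φ) i) (row-listDiagram (clauses Φ) j) i⊆j))
  where
  clause : ∀ i → Φ (List.lookup (clauses Φ) i) ≡ true
  clause i = to (∈-clauses⇔ {Φ = Φ}) (∈-lookup i)

sameImage⇒permutation : ∀ {A : Set} {a b} (f : Fin a → A) (g : Fin b → A) →
                        Injective _≡_ _≡_ f → Injective _≡_ _≡_ g →
                        (∀ x → (∃[ i ] f i ≡ x) ⇔ (∃[ j ] g j ≡ x)) →
                        ∃[ π ] (∀ i → f i ≡ g (π ⟨$⟩ʳ i))
sameImage⇒permutation f g f-injective g-injective sameImage = π , λ i → sym (proj₂ (match i))
  where
  match : ∀ i → ∃[ j ] g j ≡ f i
  match i = to (sameImage (f i)) (i , refl)
  match⁻¹ : ∀ j → ∃[ i ] f i ≡ g j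
  match⁻¹ j = from (sameImage (g j)) (j , refl)
  π = permutation (proj₁ ∘ match) (proj₁ ∘ match⁻¹)
        (λ j → g-injective (trans (proj₂ (match _)) (proj₂ (match⁻¹ j))))
        (λ i → f-injective (trans (proj₂ (match⁻¹ _)) (proj₂ (match i))))

SameRows : ∀ {m} → NormalForm m → NormalForm m → Set
SameRows (d , _) (e , _) = ∀ φ → (∃[ i ] row d i ≡ φ) ⇔ (∃[ j ] row e j ≡ φ)

sameRows⇒≈comm : ∀ {m} (x y : NormalForm m) → SameRows x y → x ≈comm y
sameRows⇒≈comm (d , d-normal) (e , e-normal) sameRows =
  let (π , rows≡) =
        sameImage⇒permutation (row d) (row e) (injective {d} d-normal) (injective {e} e-normal) sameRows
  in π , λ i k →
       trans (sym (lookup∘tabulate _ k)) (trans (cong (λ r → lookup r k) (rows≡ i)) (lookup∘tabulate _ k))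
  where
  injective : ∀ {d} → IsNormalMat (reprMatrix d) → Injective _≡_ _≡_ (row d)
  injective {d} normal rows≡ = to (normal⇔rowsAntichain d) normal (⊆-reflexive rows≡)

≈comm⇒sameRows : ∀ {m} (x y : NormalForm m) → x ≈comm y → SameRows x y
≈comm⇒sameRows (d , _) (e , _) (π , same) φ =
  mk⇔ (λ (i , dᵢ≡φ) → π ⟨$⟩ʳ i , trans (sym (rows≡ i)) dᵢ≡φ)
      (λ (j , eⱼ≡φ) → π ⟨$⟩ˡ j , trans (rows≡ _) (trans (cong (row e) (inverseʳ π)) eⱼ≡φ))
  where
  rows≡ : ∀ i → row d i ≡ row e (π ⟨$⟩ʳ i)
  rows≡ i = tabulate-cong (same i)

minClauseSet≅normalForm : ∀ m → Inverse (MinClauseSetoid m) (NormalFormSetoid m)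
minClauseSet≅normalForm m = record
  { to        = to′
  ; from      = from′
  ; to-cong   = λ {Φ} {Ψ} Φ≈Ψ → sameRows⇒≈comm (to′ Φ) (to′ Ψ) λ φ →
                  ⇔-trans (rows-to′ Φ) (⇔-trans (≡true-cong (Φ≈Ψ φ)) (⇔-sym (rows-to′ Ψ)))
  ; from-cong = λ {x} {y} x≈y φ → ⇔→≡ (⇔-trans (rowSet≡true⇔ (proj₁ x))
                  (⇔-trans (≈comm⇒sameRows x y x≈y φ) (⇔-sym (rowSet≡true⇔ (proj₁ y)))))
  ; inverse   = (λ {x} {Φ} Φ≈x → sameRows⇒≈comm (to′ Φ) x λ φ →
                  ⇔-trans (rows-to′ Φ) (⇔-trans (≡true-cong (Φ≈x φ)) (rowSet≡true⇔ (proj₁ x))))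
              , (λ {Φ} {x} x≈Φ φ → ⇔→≡ (⇔-trans (rowSet≡true⇔ (proj₁ x))
                  (⇔-trans (≈comm⇒sameRows x (to′ Φ) x≈Φ φ) (rows-to′ Φ))))
  }
  where
  to′ : MinClauseSet m → NormalForm m
  to′ (Φ , minimal) =
    clauseDiagram Φ ,
    from (normal⇔rowsAntichain (clauseDiagram Φ)) (clauseDiagram-rowsAntichain Φ (minimal⇒antichain minimal))
  from′ : NormalForm m → MinClauseSet m
  from′ (d , normal) =
    rowSet d , antichain⇒minimal (rowSet-antichain d (to (normal⇔rowsAntichain d) normal))
  rows-to′ : ∀ Φ {φ} → (∃[ i ] row (proj₁ (to′ Φ)) i ≡ φ) ⇔ proj₁ Φ φ ≡ true
  rows-to′ (Φ , _) = rows-clauseDiagram⇔ Φ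
  ≡true-cong : ∀ {a b} → a ≡ b → a ≡ true ⇔ b ≡ true
  ≡true-cong a≡b = mk⇔ (trans (sym a≡b)) (trans a≡b)

mainTheorem11 : (m : ℕ) →
    Inverse (DownSetSetoid m) (MinClauseSetoid m)
    × Inverse (MinClauseSetoid m) (NormalFormSetoid m)
    × Inverse (DownSetSetoid m) (NormalFormSetoid m)
mainTheorem11 m =
  downSet≅minClauseSet m , minClauseSet≅normalForm m ,
  Composition.inverse (downSet≅minClauseSet m) (minClauseSet≅normalForm m)
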